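{- Let $(K,\le,\wedge,\vee,0,1,{}^\bullet)$ be a coquasiintuitionistic algebra and let $K_{\bullet\bullet}:=\{x^{\bullet\bullet}\mid x\in K\}\subseteq K$, equipped with the restriction of $\le$ and of ${}^\bullet$ to $K_{\bullet\bullet}$. Then $(K_{\bullet\bullet},\le,\curlywedge,\vee,0,1,{}^\bullet)$ is an orthocomplemented lattice, where: (i) the join on $K_{\bullet\bullet}$ is the join $\vee$ of $K$ restricted to $K_{\bullet\bullet}$; (ii) the meet is given by $\alpha\curlywedge\beta:=(\alpha\wedge\beta)^{\bullet\bullet}$ for all $\alpha,\beta\in K_{\bullet\bullet}$; (iii) the bottom and top elements are $0$ and $1$; (iv) the orthocomplementation is ${}^\bullet$ (restricted).
   Context: A coquasiintuitionistic algebra is a bounded distributive lattice $(K,\le,\wedge,\vee,0,1)$ with a map ${}^\bullet:K\to K$ such that for all $x,y\in K$: $x\le y$ implies $y^\bullet\le x^\bullet$; $x^{\bullet\bullet}\le x$; $y\le x\vee x^\bullet$. An orthocomplemented lattice is a bounded lattice with a map ${}^\perp$ such that $x\le y$ implies $y^\perp\le x^\perp$, $x^{\perp\perp}=x$, $x\wedge x^\perp=0$ and $x\vee x^\perp=1$. -}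

module Defs where

open import Level using (Level; _⊔_; suc)
open import Algebra.Core using (Op₁; Op₂)
open import Data.Product using (Σ; ∃; proj₁; _×_)
open import Relation.Binary.Core using (Rel)
open import Relation.Binary.Definitions using (Minimum; Maximum)
open import Relation.Binary.Lattice.Structures
  using (IsDistributiveLattice; IsBoundedLattice)

record CoquasiIntuitionisticAlgebra (c ℓ₁ ℓ₂ : Level) : Set (suc (c ⊔ ℓ₁ ⊔ ℓ₂)) where
  infix  4 _≈_ _≤_
  infixr 6 _∨_
  infixr 7 _∧_
  infix  8 _•
  field
    Carrier : Set c
    _≈_     : Rel Carrier ℓ₁
    _≤_     : Rel Carrier ℓ₂
    _∨_     : Op₂ Carrier
    _∧_     : Op₂ Carrier
    𝟘       : Carrier
    𝟙       : Carrier
    _•      : Op₁ Carrier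
    isDistributiveLattice : IsDistributiveLattice _≈_ _≤_ _∨_ _∧_
    maximum  : Maximum _≤_ 𝟙
    minimum  : Minimum _≤_ 𝟘
    •-antitone : ∀ {x y} → x ≤ y → y • ≤ x •
    ••-≤       : ∀ x → (x •) • ≤ x
    ≤-∨-•      : ∀ x y → y ≤ x ∨ x •

record IsOrthocomplementedLattice {a ℓ₁ ℓ₂} {A : Set a}
         (_≈_ : Rel A ℓ₁) (_≤_ : Rel A ℓ₂)
         (_∨_ : Op₂ A) (_∧_ : Op₂ A) (⊤ : A) (⊥ : A) (_⊥ᶜ : Op₁ A)
         : Set (a ⊔ ℓ₁ ⊔ ℓ₂) where
  field
    isBoundedLattice : IsBoundedLattice _≈_ _≤_ _∨_ _∧_ ⊤ ⊥
    ⊥ᶜ-antitone  : ∀ {x y} → x ≤ y → (y ⊥ᶜ) ≤ (x ⊥ᶜ)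
    ⊥ᶜ-involutive : ∀ x → ((x ⊥ᶜ) ⊥ᶜ) ≈ x
    ∧-⊥ᶜ : ∀ x → (x ∧ (x ⊥ᶜ)) ≈ ⊥
    ∨-⊥ᶜ : ∀ x → (x ∨ (x ⊥ᶜ)) ≈ ⊤

module _ {c ℓ₁ ℓ₂} (K : CoquasiIntuitionisticAlgebra c ℓ₁ ℓ₂) where
  open CoquasiIntuitionisticAlgebra K

  K•• : Set (c ⊔ ℓ₁)
  K•• = Σ Carrier (λ a → ∃ λ x → a ≈ (x •) •)

  _≈ᵣ_ : Rel K•• ℓ₁
  α ≈ᵣ β = proj₁ α ≈ proj₁ β

  _≤ᵣ_ : Rel K•• ℓ₂
  α ≤ᵣ β = proj₁ α ≤ proj₁ β

-- The elements x•• are exactly the regular elements a•• ≈ a, since x••• ≈ x•.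
-- Regular elements are closed under •, ∨, 𝟘 and 𝟙, and a ↦ a•• is a closure
-- operator below every regular element, so (a ∧ b)•• is the meet of regular a, b.
-- Complementation holds because 𝟙 ≈ a ∨ a• for every a, and (a ∧ a•)• lies
-- above both a• and a••, hence above a• ∨ a•• ≈ 𝟙, so (a ∧ a•)•• ≈ 𝟙• ≈ 𝟘.
module Submission where

open import Defs
open import Data.Product using (Σ; proj₁; _×_; _,_)
open import Algebra.Core using (Op₁; Op₂)
open import Relation.Binary.Lattice.Structures
  using (IsLattice; IsBoundedLattice; IsDistributiveLattice)
import Relation.Binary.Construct.On as On

module CoquasiIntuitionisticAlgebraProperties
         {c ℓ₁ ℓ₂} (K : CoquasiIntuitionisticAlgebra c ℓ₁ ℓ₂) where
  open CoquasiIntuitionisticAlgebra K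
  open IsDistributiveLattice isDistributiveLattice

  •-cong : ∀ {x y} → x ≈ y → x • ≈ y •
  •-cong x≈y = antisym (•-antitone (reflexive (Eq.sym x≈y))) (•-antitone (reflexive x≈y))

  ••-monotone : ∀ {x y} → x ≤ y → x • • ≤ y • •
  ••-monotone x≤y = •-antitone (•-antitone x≤y)

  •••≈• : ∀ x → x • • • ≈ x •
  •••≈• x = antisym (••-≤ (x •)) (•-antitone (••-≤ x))

  x∨x•≈𝟙 : ∀ x → x ∨ x • ≈ 𝟙
  x∨x•≈𝟙 x = antisym (maximum _) (≤-∨-• x 𝟙)

  𝟘•≈𝟙 : 𝟘 • ≈ 𝟙
  𝟘•≈𝟙 = antisym (maximum _) (trans (≤-∨-• 𝟘 𝟙) (∨-least (minimum _) refl))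

  𝟙•≈𝟘 : 𝟙 • ≈ 𝟘
  𝟙•≈𝟘 = Eq.trans (•-cong (Eq.sym 𝟘•≈𝟙)) (antisym (••-≤ 𝟘) (minimum _))

  [x∧x•]•≈𝟙 : ∀ x → (x ∧ x •) • ≈ 𝟙
  [x∧x•]•≈𝟙 x = antisym (maximum _)
    (trans (≤-∨-• (x •) 𝟙) (∨-least (•-antitone (x∧y≤x x (x •))) (•-antitone (x∧y≤y x (x •)))))

  Regular : Carrier → Set ℓ₁
  Regular a = a • • ≈ a

  K••-regular : (α : K•• K) → Regular (proj₁ α)
  K••-regular (a , x , a≈x••) =
    Eq.trans (•-cong (Eq.trans (•-cong a≈x••) (•••≈• x))) (Eq.sym a≈x••)

  regular⇒K•• : ∀ {a} → Regular a → K•• K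
  regular⇒K•• {a} a••≈a = a , a , Eq.sym a••≈a

  •-regular : ∀ x → Regular (x •)
  •-regular = •••≈•

  𝟘-regular : Regular 𝟘
  𝟘-regular = antisym (••-≤ 𝟘) (minimum _)

  𝟙-regular : Regular 𝟙
  𝟙-regular = Eq.trans (•-cong 𝟙•≈𝟘) 𝟘•≈𝟙

  ≤⇒≤•• : ∀ {a x} → Regular a → a ≤ x → a ≤ x • •
  ≤⇒≤•• a••≈a a≤x = trans (reflexive (Eq.sym a••≈a)) (••-monotone a≤x)

  ∨-regular : ∀ {a b} → Regular a → Regular b → Regular (a ∨ b)
  ∨-regular {a} {b} a••≈a b••≈b = antisym (••-≤ (a ∨ b))
    (∨-least (≤⇒≤•• a••≈a (x≤x∨y a b)) (≤⇒≤•• b••≈b (y≤x∨y a b)))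

module RegularOrthocomplementedLattice
         {c ℓ₁ ℓ₂} (K : CoquasiIntuitionisticAlgebra c ℓ₁ ℓ₂) where
  open CoquasiIntuitionisticAlgebra K
  open IsDistributiveLattice isDistributiveLattice hiding (isLattice)
  open CoquasiIntuitionisticAlgebraProperties K

  _⊔_ : Op₂ (K•• K)
  α ⊔ β = regular⇒K•• (∨-regular (K••-regular α) (K••-regular β))

  _⊓_ : Op₂ (K•• K)
  α ⊓ β = (proj₁ α ∧ proj₁ β) • • , proj₁ α ∧ proj₁ β , Eq.refl

  ⊥ᵣ : K•• K
  ⊥ᵣ = regular⇒K•• 𝟘-regular

  ⊤ᵣ : K•• K
  ⊤ᵣ = regular⇒K•• 𝟙-regular

  _ᶜ : Op₁ (K•• K)
  α ᶜ = regular⇒K•• (•-regular (proj₁ α))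

  isLattice : IsLattice (_≈ᵣ_ K) (_≤ᵣ_ K) _⊔_ _⊓_
  isLattice = record
    { isPartialOrder = On.isPartialOrder proj₁ isPartialOrder
    ; supremum = λ α β → x≤x∨y _ _ , y≤x∨y _ _ , λ _ → ∨-least
    ; infimum = λ α β →
        trans (••-≤ _) (x∧y≤x _ _) , trans (••-≤ _) (x∧y≤y _ _) ,
        λ γ γ≤α γ≤β → ≤⇒≤•• (K••-regular γ) (∧-greatest γ≤α γ≤β)
    }

  isOrthocomplementedLattice :
    IsOrthocomplementedLattice (_≈ᵣ_ K) (_≤ᵣ_ K) _⊔_ _⊓_ ⊤ᵣ ⊥ᵣ _ᶜ
  isOrthocomplementedLattice = record
    { isBoundedLattice = record
      { isLattice = isLattice
      ; maximum = λ α → maximum (proj₁ α)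
      ; minimum = λ α → minimum (proj₁ α)
      }
    ; ⊥ᶜ-antitone = •-antitone
    ; ⊥ᶜ-involutive = K••-regular
    ; ∧-⊥ᶜ = λ α → Eq.trans (•-cong ([x∧x•]•≈𝟙 (proj₁ α))) 𝟙•≈𝟘
    ; ∨-⊥ᶜ = λ α → x∨x•≈𝟙 (proj₁ α)
    }

mainTheorem2 : ∀ {c ℓ₁ ℓ₂} (K : CoquasiIntuitionisticAlgebra c ℓ₁ ℓ₂) →
    let open CoquasiIntuitionisticAlgebra K in
    Σ (Op₂ (K•• K)) λ _⊔ᵣ_ → Σ (Op₂ (K•• K)) λ _⊓ᵣ_ →
    Σ (K•• K) λ 0ᵣ → Σ (K•• K) λ 1ᵣ → Σ (Op₁ (K•• K)) λ cᵣ →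
    (∀ α β → proj₁ (α ⊔ᵣ β) ≈ (proj₁ α ∨ proj₁ β)) ×
    (∀ α β → proj₁ (α ⊓ᵣ β) ≈ ((proj₁ α ∧ proj₁ β) •) •) ×
    (proj₁ 0ᵣ ≈ 𝟘) ×
    (proj₁ 1ᵣ ≈ 𝟙) ×
    (∀ α → proj₁ (cᵣ α) ≈ (proj₁ α) •) ×
    IsOrthocomplementedLattice (_≈ᵣ_ K) (_≤ᵣ_ K) _⊔ᵣ_ _⊓ᵣ_ 1ᵣ 0ᵣ cᵣ
mainTheorem2 K =
  _⊔_ , _⊓_ , ⊥ᵣ , ⊤ᵣ , _ᶜ ,
  (λ _ _ → Eq.refl) , (λ _ _ → Eq.refl) , Eq.refl , Eq.refl , (λ _ → Eq.refl) ,
  isOrthocomplementedLattice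
  where
  open RegularOrthocomplementedLattice K
  open IsDistributiveLattice (CoquasiIntuitionisticAlgebra.isDistributiveLattice K)
    using (module Eq)
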